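{- Let $p$ be a prime, $q$ a positive integer, and $A\in\{ -1,1\}^{q\times q}$ a matrix with $\mathrm{rank}(A)>1$ (rank over $\mathbb{R}$). Then there are constants $c_1>0$ and $c_2\in(0,1)$ such that for all positive integers $n$, $$\mathcal{R}^{\mathrm{bool},p}_{A^{\otimes n}}(c_1 n)\;\ge\; q^{2n}\left(\frac12-c_2^{\,n}\right).$$
   Context: $\mathbb{F}_p$ is the field with $p$ elements. For $x\in\mathbb{F}_p$ define $\mathrm{bool}(x)=1$ if $x=1$ in $\mathbb{F}_p$ and $\mathrm{bool}(x)=-1$ otherwise. For $A\in\{ -1,1\}^{N\times N}$ and real $r\ge0$, the Boolean rigidity $\mathcal{R}^{\mathrm{bool},p}_{A}(r)$ is the minimum, over all $L\in\mathbb{F}_p^{N\times N}$ with $\mathbb{F}_p$-rank at most $r$, of the number of pairs $(i,j)$ with $A[i,j]\neq\mathrm{bool}(L[i,j])$. The Kronecker power $A^{\otimes n}$ of $A\in\{ -1,1\}^{q\times q}$ is the $q^n\times q^n$ matrix with rows and columns indexed by $\{0,\dots,q-1\}^n$ and entries $A^{\otimes n}[x,y]=\prod_{i=1}^n A[x_i,y_i]$. -}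

module Defs where

open import Data.Nat as ℕ using (ℕ; zero; suc; NonZero)
open import Data.Nat.DivMod using (_mod_)
open import Data.Fin using (Fin; toℕ)
open import Data.Vec using (Vec; []; _∷_)
open import Data.Integer as ℤ using (ℤ; +_; -[1+_])
open import Data.Rational as ℚ using (ℚ)
open import Relation.Nullary using (¬_; Dec; yes; no)
open import Relation.Binary.PropositionalEquality using (_≡_)
open import Data.Product using (Σ; ∃; _×_)

sumFin : ∀ k → (Fin k → ℕ) → ℕ
sumFin zero    f = 0
sumFin (suc k) f = f Fin.zero ℕ.+ sumFin k (λ i → f (Fin.suc i))
  where import Data.Fin as Fin

sumTuples : ∀ q n → (Vec (Fin q) n → ℕ) → ℕ
sumTuples q zero    f = f []
sumTuples q (suc n) f = sumFin q (λ a → sumTuples q n (λ v → f (a ∷ v)))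

IsSignMatrix : ∀ {I : Set} → (I → I → ℤ) → Set
IsSignMatrix A = ∀ i j → (A i j ≡ + 1) Data.Sum.⊎ (A i j ≡ -[1+ 0 ])
  where import Data.Sum

-- Kronecker power A^{⊗n}[x,y] = ∏ A[x_i,y_i].
kronPow : ∀ {q} → (Fin q → Fin q → ℤ) → ∀ n → Vec (Fin q) n → Vec (Fin q) n → ℤ
kronPow A zero    []       []       = + 1
kronPow A (suc n) (x ∷ xs) (y ∷ ys) = A x y ℤ.* kronPow A n xs ys

-- The field F_p: elements Fin p, with p prime (NonZero p is implied).
-- bool(x) = 1 if x = 1 in F_p, -1 otherwise.
boolF : ∀ {p} → Fin p → ℤ
boolF x with toℕ x ℕ.≟ 1
... | yes _ = + 1
... | no  _ = -[1+ 0 ]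

-- An F_p-matrix L (rows/cols indexed by I) has F_p-rank at most r (r ∈ ℕ)
-- iff L = U V over F_p for some U : I × r, V : r × I.
-- Matrix product computed in ℕ on representatives and reduced mod p.
RankFpAtMost : ∀ p .{{_ : NonZero p}} {I : Set} → (I → I → Fin p) → ℕ → Set
RankFpAtMost p {I} L r =
  Σ (I → Fin r → Fin p) λ U → Σ (Fin r → I → Fin p) λ V →
    ∀ i j → L i j ≡ (sumFin r (λ k → toℕ (U i k) ℕ.* toℕ (V k j))) mod p

mismatches : ∀ {p q} n → (Vec (Fin q) n → Vec (Fin q) n → ℤ)
           → (Vec (Fin q) n → Vec (Fin q) n → Fin p) → ℕ
mismatches {q = q} n M L =
  sumTuples q n λ x → sumTuples q n λ y → ind (M x y) (boolF (L x y))
  where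
  ind : ℤ → ℤ → ℕ
  ind a b with a ℤ.≟ b
  ... | yes _ = 0
  ... | no  _ = 1

-- Rank over ℝ of an integer matrix equals rank over ℚ; rank(A) ≤ 1 iff
-- A = u vᵀ for some column vectors u, v (over ℚ).
RankℚAtMostOne : ∀ {q} → (Fin q → Fin q → ℤ) → Set
RankℚAtMostOne {q} A =
  Σ (Fin q → ℚ) λ u → Σ (Fin q → ℚ) λ v → ∀ i j → A i j ℚ./ 1 ≡ u i ℚ.* v j

ℕtoℚ : ℕ → ℚ
ℕtoℚ n = (+ n) ℚ./ 1

powℚ : ℚ → ℕ → ℚ
powℚ c zero    = ℚ.1ℚ
powℚ c (suc n) = c ℚ.* powℚ c n

-- Boolean rigidity lower bound: R^{bool,p}_M(s) ≥ b, i.e. every L of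
-- F_p-rank ≤ s (real s, here rational) differs from M in ≥ b positions.
-- (rank ≤ s for integer rank r means r ≤ s.)
RigidityAtLeast : ∀ p .{{_ : NonZero p}} {q} n
  → (Vec (Fin q) n → Vec (Fin q) n → ℤ) → ℚ → ℚ → Set
RigidityAtLeast p {q} n M s b =
  ∀ (r : ℕ) → ℕtoℚ r ℚ.≤ s →
  ∀ (L : Vec (Fin q) n → Vec (Fin q) n → Fin p) → RankFpAtMost p L r →
  b ℚ.≤ ℕtoℚ (mismatches n M L)

{-# OPTIONS --safe #-}
-- Write M = A^{⊗n}, N = q^n and B[x,y] = bool(L[x,y]). Both are ±1 matrices, so
-- 2·#{M ≠ B} = N² − ⟨M,B⟩ and it suffices to show that the correlation ⟨M,B⟩ is exponentially
-- smaller than N². If L = UV has F_p-rank r, then B[x,y] depends only on x and on the column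
-- label V[·,y] ∈ F_p^r, which takes at most p^r values. Grouping the columns by label and applying
-- Cauchy–Schwarz gives ⟨M,B⟩² ≤ p^r·N·Σ_{y,z} |(MᵀM)[y,z]|, and as MᵀM = (AᵀA)^{⊗n} this sum is
-- g^n, where g is the entrywise ℓ₁ norm of the Gram matrix AᵀA. Each entry of AᵀA has absolute
-- value at most q, and since rank A > 1 some pair of columns is neither equal nor opposite, which
-- makes one entry at most q − 2; hence g ≤ q³ − 2 and ⟨M,B⟩² ≤ p^r·N⁴·(g/q³)^n. For r ≤ c₁n a
-- Bernoulli-type inequality p^r·y^n ≤ (1+y)^n absorbs p^r, leaving ⟨M,B⟩ ≤ N²·((g+1)/(g+2))^n.
module Submission where

open import Defs

module IntegerLemmas where

  open import Data.Nat as ℕ using (zero; suc; z≤n; _^_)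
  open import Data.Integer using (+_; -[1+_]; _+_; _*_; -_; _≤_; +≤+; -≤+; 0ℤ; ∣_∣) renaming (_^_ to _^ᶻ_)
  import Data.Integer.Properties as ℤ
  open import Data.Integer.Tactic.RingSolver using (solve-∀)
  open import Relation.Binary.PropositionalEquality using (_≡_; refl; sym; trans; cong; subst)

  i≤+∣i∣ : ∀ i → i ≤ + ∣ i ∣
  i≤+∣i∣ (+ n)    = ℤ.≤-refl
  i≤+∣i∣ -[1+ n ] = -≤+

  0≤i*i : ∀ i → 0ℤ ≤ i * i
  0≤i*i (+ n)    = subst (0ℤ ≤_) (ℤ.pos-* n n) (+≤+ z≤n)
  0≤i*i -[1+ n ] = +≤+ z≤n

  +[∣i∣*∣i∣]≡i*i : ∀ i → + (∣ i ∣ ℕ.* ∣ i ∣) ≡ i * i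
  +[∣i∣*∣i∣]≡i*i i = trans (cong +_ (sym (ℤ.abs-* i i))) (ℤ.0≤i⇒+∣i∣≡i (0≤i*i i))

  pos-^ : ∀ m n → + (m ^ n) ≡ (+ m) ^ᶻ n
  pos-^ m zero    = refl
  pos-^ m (suc n) = trans (ℤ.pos-* m (m ^ n)) (cong (+ m *_) (pos-^ m n))

  +-cancelˡ-≤ : ∀ a {b c} → a + b ≤ a + c → b ≤ c
  +-cancelˡ-≤ a {b} {c} a+b≤a+c = begin
    b               ≡⟨ cancel a b ⟨
    - a + (a + b)   ≤⟨ ℤ.+-monoʳ-≤ (- a) a+b≤a+c ⟩
    - a + (a + c)   ≡⟨ cancel a c ⟩
    c               ∎
    where
    open ℤ.≤-Reasoning
    cancel : ∀ a b → - a + (a + b) ≡ b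
    cancel = solve-∀

open IntegerLemmas

module FiniteSum where

  open import Data.Integer using (ℤ; +_; _+_; _*_; -_; _≤_; +≤+; 0ℤ; 1ℤ; ∣_∣)
  import Data.Integer.Properties as ℤ
  open import Data.Integer.Tactic.RingSolver using (solve-∀)
  open import Data.List using (List; []; _∷_; _++_; map; length; cartesianProductWith)
  open import Data.List.Membership.Propositional using (_∈_)
  open import Data.List.Relation.Unary.Any using (here; there)
  open import Function using (_∘_)
  open import Relation.Binary.PropositionalEquality using (_≡_; refl; sym; trans; cong; cong₂; module ≡-Reasoning)

  private
    variable
      I J K : Set

  ∑ : List I → (I → ℤ) → ℤ
  ∑ []       f = 0ℤ
  ∑ (x ∷ xs) f = f x + ∑ xs f

  ∑-syntax : List I → (I → ℤ) → ℤ
  ∑-syntax = ∑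

  -- The body of ∑[ x ∈ xs ] extends over + and *: ∑[ i ∈ xs ] f i + c sums f i + c.
  infix 5 ∑-syntax
  syntax ∑-syntax xs (λ x → e) = ∑[ x ∈ xs ] e

  ∑-cong : ∀ (xs : List I) {f g : I → ℤ} → (∀ i → f i ≡ g i) → ∑ xs f ≡ ∑ xs g
  ∑-cong []       f≗g = refl
  ∑-cong (x ∷ xs) f≗g = cong₂ _+_ (f≗g x) (∑-cong xs f≗g)

  ∑-distrib-+ : ∀ (xs : List I) (f g : I → ℤ) → ∑[ i ∈ xs ] (f i + g i) ≡ ∑ xs f + ∑ xs g
  ∑-distrib-+ []       f g = refl
  ∑-distrib-+ (x ∷ xs) f g =
    trans (cong (_+_ (f x + g x)) (∑-distrib-+ xs f g)) (middle-swap (f x) (g x) (∑ xs f) (∑ xs g))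
    where
    middle-swap : ∀ a b c d → a + b + (c + d) ≡ a + c + (b + d)
    middle-swap = solve-∀

  *-distribˡ-∑ : ∀ (xs : List I) c (f : I → ℤ) → c * ∑ xs f ≡ ∑[ i ∈ xs ] (c * f i)
  *-distribˡ-∑ []       c f = ℤ.*-zeroʳ c
  *-distribˡ-∑ (x ∷ xs) c f =
    trans (ℤ.*-distribˡ-+ c (f x) (∑ xs f)) (cong (_+_ (c * f x)) (*-distribˡ-∑ xs c f))

  *-distribʳ-∑ : ∀ (xs : List I) c (f : I → ℤ) → ∑ xs f * c ≡ ∑[ i ∈ xs ] (f i * c)
  *-distribʳ-∑ xs c f = begin
    ∑ xs f * c          ≡⟨ ℤ.*-comm (∑ xs f) c ⟩
    c * ∑ xs f          ≡⟨ *-distribˡ-∑ xs c f ⟩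
    ∑[ i ∈ xs ] c * f i ≡⟨ ∑-cong xs (λ i → ℤ.*-comm c (f i)) ⟩
    ∑[ i ∈ xs ] f i * c ∎
    where open ≡-Reasoning

  neg-distrib-∑ : ∀ (xs : List I) (f : I → ℤ) → - ∑ xs f ≡ ∑[ i ∈ xs ] - f i
  neg-distrib-∑ []       f = refl
  neg-distrib-∑ (x ∷ xs) f =
    trans (ℤ.neg-distrib-+ (f x) (∑ xs f)) (cong (_+_ (- f x)) (neg-distrib-∑ xs f))

  ∑-const : ∀ (xs : List I) c → ∑[ i ∈ xs ] c ≡ + length xs * c
  ∑-const []       c = sym (ℤ.*-zeroˡ c)
  ∑-const (x ∷ xs) c = trans (cong (_+_ c) (∑-const xs c)) (suc-* c (+ length xs))
    where
    suc-* : ∀ c n → c + n * c ≡ (1ℤ + n) * c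
    suc-* = solve-∀

  ∑-mono-≤ : ∀ (xs : List I) {f g : I → ℤ} → (∀ i → f i ≤ g i) → ∑ xs f ≤ ∑ xs g
  ∑-mono-≤ []       f≤g = ℤ.≤-refl
  ∑-mono-≤ (x ∷ xs) f≤g = ℤ.+-mono-≤ (f≤g x) (∑-mono-≤ xs f≤g)

  ∑-mono-≤-gap : ∀ (xs : List I) {f g : I → ℤ} {j} d → (∀ i → f i ≤ g i) → j ∈ xs →
                 f j + d ≤ g j → ∑ xs f + d ≤ ∑ xs g
  ∑-mono-≤-gap (x ∷ xs) {f} {g} d f≤g (here refl) gap = begin
    f x + ∑ xs f + d ≡⟨ +-swapʳ (f x) (∑ xs f) d ⟩
    f x + d + ∑ xs f ≤⟨ ℤ.+-mono-≤ gap (∑-mono-≤ xs f≤g) ⟩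
    g x + ∑ xs g     ∎
    where
    open ℤ.≤-Reasoning
    +-swapʳ : ∀ a b c → a + b + c ≡ a + c + b
    +-swapʳ = solve-∀
  ∑-mono-≤-gap (x ∷ xs) {f} {g} d f≤g (there j∈xs) gap = begin
    f x + ∑ xs f + d   ≡⟨ ℤ.+-assoc (f x) (∑ xs f) d ⟩
    f x + (∑ xs f + d) ≤⟨ ℤ.+-mono-≤ (f≤g x) (∑-mono-≤-gap xs d f≤g j∈xs gap) ⟩
    g x + ∑ xs g       ∎
    where open ℤ.≤-Reasoning

  ∣∑∣≤∑∣∣ : ∀ (xs : List I) (f : I → ℤ) → + ∣ ∑ xs f ∣ ≤ ∑[ i ∈ xs ] + ∣ f i ∣
  ∣∑∣≤∑∣∣ []       f = ℤ.≤-refl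
  ∣∑∣≤∑∣∣ (x ∷ xs) f =
    ℤ.≤-trans (+≤+ (ℤ.∣i+j∣≤∣i∣+∣j∣ (f x) (∑ xs f))) (ℤ.+-monoʳ-≤ (+ ∣ f x ∣) (∣∑∣≤∑∣∣ xs f))

  ∑-nonNeg : ∀ (xs : List I) {f : I → ℤ} → (∀ i → 0ℤ ≤ f i) → 0ℤ ≤ ∑ xs f
  ∑-nonNeg []       0≤f = ℤ.≤-refl
  ∑-nonNeg (x ∷ xs) 0≤f = ℤ.+-mono-≤ (0≤f x) (∑-nonNeg xs 0≤f)

  ∑-zero : ∀ (xs : List I) (f : I → ℤ) → (∀ i → f i ≡ 0ℤ) → ∑ xs f ≡ 0ℤ
  ∑-zero []       f f≡0 = refl
  ∑-zero (x ∷ xs) f f≡0 = cong₂ _+_ (f≡0 x) (∑-zero xs f f≡0)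

  ∑-++ : ∀ (xs ys : List I) (f : I → ℤ) → ∑ (xs ++ ys) f ≡ ∑ xs f + ∑ ys f
  ∑-++ []       ys f = sym (ℤ.+-identityˡ (∑ ys f))
  ∑-++ (x ∷ xs) ys f = trans (cong (_+_ (f x)) (∑-++ xs ys f)) (sym (ℤ.+-assoc (f x) (∑ xs f) (∑ ys f)))

  ∑-map : ∀ (g : J → I) (xs : List J) (f : I → ℤ) → ∑ (map g xs) f ≡ ∑ xs (f ∘ g)
  ∑-map g []       f = refl
  ∑-map g (x ∷ xs) f = cong (_+_ (f (g x))) (∑-map g xs f)

  ∑-comm : ∀ (xs : List I) (ys : List J) (f : I → J → ℤ) →
           ∑[ i ∈ xs ] ∑[ j ∈ ys ] f i j ≡ ∑[ j ∈ ys ] ∑[ i ∈ xs ] f i j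
  ∑-comm []       ys f = sym (∑-zero ys (λ _ → 0ℤ) (λ _ → refl))
  ∑-comm (x ∷ xs) ys f =
    trans (cong (_+_ (∑ ys (f x))) (∑-comm xs ys f)) (sym (∑-distrib-+ ys (f x) (λ j → ∑[ i ∈ xs ] f i j)))

  ∑-cartesianProductWith : ∀ (g : I → J → K) (xs : List I) (ys : List J) (f : K → ℤ) →
    ∑ (cartesianProductWith g xs ys) f ≡ ∑[ i ∈ xs ] ∑[ j ∈ ys ] f (g i j)
  ∑-cartesianProductWith g []       ys f = refl
  ∑-cartesianProductWith g (x ∷ xs) ys f = begin
    ∑ (map (g x) ys ++ cartesianProductWith g xs ys) f
      ≡⟨ ∑-++ (map (g x) ys) _ f ⟩
    ∑ (map (g x) ys) f + ∑ (cartesianProductWith g xs ys) f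
      ≡⟨ cong₂ _+_ (∑-map (g x) ys f) (∑-cartesianProductWith g xs ys f) ⟩
    (∑[ j ∈ ys ] f (g x j)) + (∑[ i ∈ xs ] ∑[ j ∈ ys ] f (g i j)) ∎
    where open ≡-Reasoning

  ∑∑-*-∑∑ : ∀ (xs : List I) (ys : List J) (f : I → I → ℤ) (g : J → J → ℤ) →
            ∑[ a ∈ xs ] ∑[ b ∈ xs ] ∑[ y ∈ ys ] ∑[ z ∈ ys ] f a b * g y z
            ≡ (∑[ a ∈ xs ] ∑[ b ∈ xs ] f a b) * (∑[ y ∈ ys ] ∑[ z ∈ ys ] g y z)
  ∑∑-*-∑∑ xs ys f g = begin
    ∑[ a ∈ xs ] ∑[ b ∈ xs ] ∑[ y ∈ ys ] ∑[ z ∈ ys ] f a b * g y z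
      ≡⟨ ∑-cong xs (λ a → ∑-cong xs (λ b → trans (∑-cong ys (λ y → sym (*-distribˡ-∑ ys (f a b) (g y))))
                                                 (sym (*-distribˡ-∑ ys (f a b) _)))) ⟩
    ∑[ a ∈ xs ] ∑[ b ∈ xs ] f a b * G
      ≡⟨ ∑-cong xs (λ a → sym (*-distribʳ-∑ xs G (f a))) ⟩
    ∑[ a ∈ xs ] (∑[ b ∈ xs ] f a b) * G
      ≡⟨ sym (*-distribʳ-∑ xs G _) ⟩
    (∑[ a ∈ xs ] ∑[ b ∈ xs ] f a b) * G ∎
    where
    open ≡-Reasoning
    G : ℤ
    G = ∑[ y ∈ ys ] ∑[ z ∈ ys ] g y z

open FiniteSum

module Enumeration where

  open import Data.Nat as ℕ using (ℕ; zero; suc; _^_)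
  import Data.Nat.Properties as ℕ
  open import Data.Integer using (ℤ; +_; _+_; _*_)
  import Data.Integer.Properties as ℤ
  open import Data.Fin using (Fin; zero; suc)
  open import Data.Vec using (Vec; []; _∷_)
  open import Data.List using (List; []; _∷_; [_]; _++_; map; length; tabulate; allFin; cartesianProductWith)
  import Data.List.Properties as List
  open import Function using (id)
  open import Relation.Binary.PropositionalEquality using (_≡_; refl; sym; trans; cong; cong₂; module ≡-Reasoning)
  open ≡-Reasoning

  length-allFin : ∀ k → length (allFin k) ≡ k
  length-allFin k = List.length-tabulate {n = k} id

  ∑-allFin-const : ∀ k c → ∑[ i ∈ allFin k ] c ≡ + k * c
  ∑-allFin-const k c = trans (∑-const (allFin k) c) (cong (λ n → + n * c) (length-allFin k))

  ∑-allFin-suc : ∀ k (f : Fin (suc k) → ℤ) → ∑ (allFin (suc k)) f ≡ f zero + (∑[ i ∈ allFin k ] f (suc i))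
  ∑-allFin-suc k f = cong (_+_ (f zero)) (begin
    ∑ (tabulate suc) f           ≡⟨ cong (λ xs → ∑ xs f) (List.map-tabulate id suc) ⟨
    ∑ (map suc (allFin k)) f     ≡⟨ ∑-map suc (allFin k) f ⟩
    ∑[ i ∈ allFin k ] f (suc i)  ∎)

  tuples : ∀ q n → List (Vec (Fin q) n)
  tuples q zero    = [ [] ]
  tuples q (suc n) = cartesianProductWith _∷_ (allFin q) (tuples q n)

  ∑-tuples-zero : ∀ q (f : Vec (Fin q) zero → ℤ) → ∑ (tuples q zero) f ≡ f []
  ∑-tuples-zero q f = ℤ.+-identityʳ (f [])

  ∑-tuples-suc : ∀ q n (f : Vec (Fin q) (suc n) → ℤ) →
                 ∑ (tuples q (suc n)) f ≡ ∑[ a ∈ allFin q ] ∑[ v ∈ tuples q n ] f (a ∷ v)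
  ∑-tuples-suc q n = ∑-cartesianProductWith _∷_ (allFin q) (tuples q n)

  length-cartesianProductWith : ∀ {A B C : Set} (g : A → B → C) (xs : List A) (ys : List B) →
    length (cartesianProductWith g xs ys) ≡ length xs ℕ.* length ys
  length-cartesianProductWith g []       ys = refl
  length-cartesianProductWith g (x ∷ xs) ys = begin
    length (map (g x) ys ++ cartesianProductWith g xs ys)     ≡⟨ List.length-++ (map (g x) ys) ⟩
    length (map (g x) ys) ℕ.+ length (cartesianProductWith g xs ys)
      ≡⟨ cong₂ ℕ._+_ (List.length-map (g x) ys) (length-cartesianProductWith g xs ys) ⟩
    length ys ℕ.+ length xs ℕ.* length ys                     ∎

  length-tuples : ∀ q n → length (tuples q n) ≡ q ^ n
  length-tuples q zero    = refl
  length-tuples q (suc n) = trans (length-cartesianProductWith _∷_ (allFin q) (tuples q n))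
    (cong₂ ℕ._*_ (length-allFin q) (length-tuples q n))

  sumFin-cong : ∀ k {f g : Fin k → ℕ} → (∀ i → f i ≡ g i) → sumFin k f ≡ sumFin k g
  sumFin-cong zero    f≗g = refl
  sumFin-cong (suc k) f≗g = cong₂ ℕ._+_ (f≗g zero) (sumFin-cong k (λ i → f≗g (suc i)))

  sumFin-∑ : ∀ k (f : Fin k → ℕ) → + sumFin k f ≡ ∑[ i ∈ allFin k ] + f i
  sumFin-∑ zero    f = refl
  sumFin-∑ (suc k) f = begin
    + (f zero ℕ.+ sumFin k (λ i → f (suc i)))         ≡⟨ ℤ.pos-+ (f zero) _ ⟩
    + f zero + + sumFin k (λ i → f (suc i))           ≡⟨ cong (_+_ (+ f zero)) (sumFin-∑ k (λ i → f (suc i))) ⟩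
    + f zero + (∑[ i ∈ allFin k ] + f (suc i))        ≡⟨ ∑-allFin-suc k (λ i → + f i) ⟨
    ∑[ i ∈ allFin (suc k) ] + f i                     ∎

  sumTuples-∑ : ∀ q n (f : Vec (Fin q) n → ℕ) → + sumTuples q n f ≡ ∑[ v ∈ tuples q n ] + f v
  sumTuples-∑ q zero    f = sym (∑-tuples-zero q (λ v → + f v))
  sumTuples-∑ q (suc n) f = begin
    + sumFin q (λ a → sumTuples q n (λ v → f (a ∷ v)))      ≡⟨ sumFin-∑ q _ ⟩
    ∑[ a ∈ allFin q ] + sumTuples q n (λ v → f (a ∷ v))     ≡⟨ ∑-cong (allFin q) (λ a → sumTuples-∑ q n (λ v → f (a ∷ v))) ⟩
    ∑[ a ∈ allFin q ] ∑[ v ∈ tuples q n ] + f (a ∷ v)       ≡⟨ ∑-tuples-suc q n (λ v → + f v) ⟨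
    ∑[ v ∈ tuples q (suc n) ] + f v                         ∎

open Enumeration

module Signs where

  open import Data.Nat as ℕ using (zero; suc)
  open import Data.Integer using (ℤ; +_; -[1+_]; _+_; _*_; -_; _≤_; -≤+; 1ℤ; -1ℤ; ∣_∣)
  import Data.Integer.Properties as ℤ
  open import Data.Fin using (Fin; toℕ)
  open import Data.Vec using ([]; _∷_)
  open import Data.List using (List; length)
  open import Data.List.Membership.Propositional using (_∈_)
  open import Data.Product using (_×_; _,_)
  open import Data.Sum using (_⊎_; inj₁; inj₂)
  open import Data.Empty using (⊥-elim)
  open import Relation.Nullary using (yes; no)
  open import Relation.Binary.PropositionalEquality using (_≡_; _≢_; refl; sym; trans; cong; subst)

  IsSign : ℤ → Set
  IsSign x = x ≡ 1ℤ ⊎ x ≡ -1ℤ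

  sign-* : ∀ {x y} → IsSign x → IsSign y → IsSign (x * y)
  sign-* (inj₁ refl) (inj₁ refl) = inj₁ refl
  sign-* (inj₁ refl) (inj₂ refl) = inj₂ refl
  sign-* (inj₂ refl) (inj₁ refl) = inj₂ refl
  sign-* (inj₂ refl) (inj₂ refl) = inj₁ refl

  sign-neg : ∀ {x} → IsSign x → IsSign (- x)
  sign-neg (inj₁ refl) = inj₂ refl
  sign-neg (inj₂ refl) = inj₁ refl

  sign-≤1 : ∀ {x} → IsSign x → x ≤ 1ℤ
  sign-≤1 (inj₁ refl) = ℤ.≤-refl
  sign-≤1 (inj₂ refl) = -≤+

  sign-sq : ∀ {x} → IsSign x → x * x ≡ 1ℤ
  sign-sq (inj₁ refl) = refl
  sign-sq (inj₂ refl) = refl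

  ∣sign∣ : ∀ {x} → IsSign x → + ∣ x ∣ ≡ 1ℤ
  ∣sign∣ (inj₁ refl) = refl
  ∣sign∣ (inj₂ refl) = refl

  distinct-signs : ∀ {x y} → IsSign x → IsSign y → x ≢ y → (x ≡ 1ℤ × y ≡ -1ℤ) ⊎ (x ≡ -1ℤ × y ≡ 1ℤ)
  distinct-signs (inj₁ refl) (inj₁ refl) x≢y = ⊥-elim (x≢y refl)
  distinct-signs (inj₁ refl) (inj₂ refl) x≢y = inj₁ (refl , refl)
  distinct-signs (inj₂ refl) (inj₁ refl) x≢y = inj₂ (refl , refl)
  distinct-signs (inj₂ refl) (inj₂ refl) x≢y = ⊥-elim (x≢y refl)

  kronPow-sign : ∀ {q} {A : Fin q → Fin q → ℤ} → IsSignMatrix A → ∀ n x y → IsSign (kronPow A n x y)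
  kronPow-sign A± zero    []      []      = inj₁ refl
  kronPow-sign A± (suc n) (a ∷ x) (b ∷ y) = sign-* (A± a b) (kronPow-sign A± n x y)

  boolF-sign : ∀ {p} (x : Fin p) → IsSign (boolF x)
  boolF-sign x with toℕ x ℕ.≟ 1
  ... | yes _ = inj₁ refl
  ... | no  _ = inj₂ refl

  private
    +∣i∣+j≤k : ∀ i {j k} → i + j ≤ k → - i + j ≤ k → + ∣ i ∣ + j ≤ k
    +∣i∣+j≤k (+ n)    i+j≤k -i+j≤k = i+j≤k
    +∣i∣+j≤k -[1+ n ] i+j≤k -i+j≤k = -i+j≤k

  ∣∑signs∣≤length : ∀ {I : Set} (xs : List I) {t : I → ℤ} → (∀ i → IsSign (t i)) →
                    + ∣ ∑ xs t ∣ ≤ + length xs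
  ∣∑signs∣≤length xs {t} t± = begin
    + ∣ ∑ xs t ∣          ≤⟨ ∣∑∣≤∑∣∣ xs t ⟩
    ∑[ i ∈ xs ] + ∣ t i ∣ ≡⟨ ∑-cong xs (λ i → ∣sign∣ (t± i)) ⟩
    ∑[ i ∈ xs ] 1ℤ        ≡⟨ ∑-const xs 1ℤ ⟩
    + length xs * 1ℤ      ≡⟨ ℤ.*-identityʳ (+ length xs) ⟩
    + length xs           ∎
    where open ℤ.≤-Reasoning

  ∑signs+2≤length : ∀ {I : Set} (xs : List I) {t : I → ℤ} → (∀ i → IsSign (t i)) →
                    ∀ {k} → k ∈ xs → t k ≡ -1ℤ → ∑ xs t + + 2 ≤ + length xs
  ∑signs+2≤length xs {t} t± k∈xs tk≡-1 = subst (∑ xs t + + 2 ≤_) (trans (∑-const xs 1ℤ) (ℤ.*-identityʳ (+ length xs)))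
    (∑-mono-≤-gap xs (+ 2) (λ i → sign-≤1 (t± i)) k∈xs (ℤ.≤-reflexive (cong (_+ + 2) tk≡-1)))

  ∣∑signs∣+2≤length : ∀ {I : Set} (xs : List I) {t : I → ℤ} → (∀ i → IsSign (t i)) →
                      ∀ {j k} → j ∈ xs → k ∈ xs → t j ≡ 1ℤ → t k ≡ -1ℤ → + ∣ ∑ xs t ∣ + + 2 ≤ + length xs
  ∣∑signs∣+2≤length xs {t} t± j∈xs k∈xs tj≡1 tk≡-1 = +∣i∣+j≤k (∑ xs t)
    (∑signs+2≤length xs t± k∈xs tk≡-1)
    (subst (λ s → s + + 2 ≤ + length xs) (sym (neg-distrib-∑ xs t))
      (∑signs+2≤length xs (λ i → sign-neg (t± i)) j∈xs (cong -_ tj≡1)))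

open Signs

module KroneckerDelta where

  open import Data.Nat using (zero; suc; z≤n)
  open import Data.Integer using (ℤ; +_; _+_; _*_; _≤_; +≤+; 0ℤ; 1ℤ; ∣_∣)
  import Data.Integer.Properties as ℤ
  open import Data.Fin using (Fin; zero; suc)
  open import Data.Vec using (Vec; []; _∷_)
  open import Data.List using (allFin)
  open import Data.Sum using (_⊎_; inj₁; inj₂)
  open import Relation.Binary.PropositionalEquality using (_≡_; refl; sym; trans; cong; module ≡-Reasoning)
  open ≡-Reasoning

  δ : ∀ {k} → Fin k → Fin k → ℤ
  δ zero    zero    = 1ℤ
  δ zero    (suc _) = 0ℤ
  δ (suc _) zero    = 0ℤ
  δ (suc a) (suc b) = δ a b

  ∑-δ : ∀ {k} (a : Fin k) (F : Fin k → ℤ) → ∑[ b ∈ allFin k ] δ a b * F b ≡ F a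
  ∑-δ {suc k} zero    F = begin
    ∑[ b ∈ allFin (suc k) ] δ zero b * F b            ≡⟨ ∑-allFin-suc k (λ b → δ zero b * F b) ⟩
    1ℤ * F zero + (∑[ b ∈ allFin k ] 0ℤ * F (suc b))
      ≡⟨ cong (_+_ (1ℤ * F zero)) (∑-zero (allFin k) _ (λ b → ℤ.*-zeroˡ (F (suc b)))) ⟩
    1ℤ * F zero + 0ℤ                                  ≡⟨ trans (ℤ.+-identityʳ _) (ℤ.*-identityˡ (F zero)) ⟩
    F zero                                            ∎
  ∑-δ {suc k} (suc a) F = begin
    ∑[ b ∈ allFin (suc k) ] δ (suc a) b * F b               ≡⟨ ∑-allFin-suc k (λ b → δ (suc a) b * F b) ⟩
    0ℤ * F zero + (∑[ b ∈ allFin k ] δ a b * F (suc b))     ≡⟨ ℤ.+-identityˡ _ ⟩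
    ∑[ b ∈ allFin k ] δ a b * F (suc b)                     ≡⟨ ∑-δ a (λ b → F (suc b)) ⟩
    F (suc a)                                               ∎

  ∑-kronPow-δ : ∀ {k} r (w : Vec (Fin k) r) (F : Vec (Fin k) r → ℤ) →
                ∑[ v ∈ tuples k r ] kronPow δ r w v * F v ≡ F w
  ∑-kronPow-δ {k} zero    []      F = trans (∑-tuples-zero k (λ v → kronPow δ zero [] v * F v)) (ℤ.*-identityˡ (F []))
  ∑-kronPow-δ {k} (suc r) (a ∷ w) F = begin
    ∑[ v ∈ tuples k (suc r) ] kronPow δ (suc r) (a ∷ w) v * F v
      ≡⟨ ∑-tuples-suc k r _ ⟩
    ∑[ b ∈ allFin k ] ∑[ v ∈ tuples k r ] δ a b * kronPow δ r w v * F (b ∷ v)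
      ≡⟨ ∑-cong (allFin k) (λ b → trans (∑-cong (tuples k r) (λ v → ℤ.*-assoc (δ a b) _ _))
                                        (sym (*-distribˡ-∑ (tuples k r) (δ a b) _))) ⟩
    ∑[ b ∈ allFin k ] δ a b * (∑[ v ∈ tuples k r ] kronPow δ r w v * F (b ∷ v))
      ≡⟨ ∑-cong (allFin k) (λ b → cong (δ a b *_) (∑-kronPow-δ r w (λ v → F (b ∷ v)))) ⟩
    ∑[ b ∈ allFin k ] δ a b * F (b ∷ w)
      ≡⟨ ∑-δ a (λ b → F (b ∷ w)) ⟩
    F (a ∷ w) ∎

  IsBit : ℤ → Set
  IsBit d = d ≡ 0ℤ ⊎ d ≡ 1ℤ

  bit-* : ∀ {d e} → IsBit d → IsBit e → IsBit (d * e)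
  bit-* (inj₁ refl) _           = inj₁ refl
  bit-* (inj₂ refl) (inj₁ refl) = inj₁ refl
  bit-* (inj₂ refl) (inj₂ refl) = inj₂ refl

  δ-bit : ∀ {k} (a b : Fin k) → IsBit (δ a b)
  δ-bit zero    zero    = inj₂ refl
  δ-bit zero    (suc _) = inj₁ refl
  δ-bit (suc _) zero    = inj₁ refl
  δ-bit (suc a) (suc b) = δ-bit a b

  kronPow-δ-bit : ∀ {k} r (w v : Vec (Fin k) r) → IsBit (kronPow δ r w v)
  kronPow-δ-bit zero    []      []      = inj₂ refl
  kronPow-δ-bit (suc r) (a ∷ w) (b ∷ v) = bit-* (δ-bit a b) (kronPow-δ-bit r w v)

  bit-*-≤-∣∣ : ∀ {d} → IsBit d → ∀ x → d * x ≤ + ∣ x ∣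
  bit-*-≤-∣∣ (inj₁ refl) x = +≤+ z≤n
  bit-*-≤-∣∣ (inj₂ refl) x = ℤ.≤-trans (ℤ.≤-reflexive (ℤ.*-identityˡ x)) (i≤+∣i∣ x)

open KroneckerDelta

module Gram where

  open import Data.Nat using (ℕ; zero; suc)
  open import Data.Integer using (ℤ; +_; _*_; _^_; ∣_∣)
  import Data.Integer.Properties as ℤ
  open import Algebra.Properties.CommutativeSemigroup ℤ.*-commutativeSemigroup using (interchange)
  open import Data.Fin using (Fin)
  open import Data.Vec using ([]; _∷_)
  open import Data.List using (List; allFin)
  open import Relation.Binary.PropositionalEquality using (_≡_; refl; sym; trans; cong; module ≡-Reasoning)
  open ≡-Reasoning

  gram : ∀ {I : Set} → List I → (I → I → ℤ) → I → I → ℤ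
  gram X M y z = ∑[ x ∈ X ] M x y * M x z

  ℓ₁ : ∀ {I : Set} → List I → (I → I → ℤ) → ℤ
  ℓ₁ X B = ∑[ y ∈ X ] ∑[ z ∈ X ] + ∣ B y z ∣

  module _ {q : ℕ} where

    gram-kronPow : ∀ (A : Fin q → Fin q → ℤ) n y z →
                   gram (tuples q n) (kronPow A n) y z ≡ kronPow (gram (allFin q) A) n y z
    gram-kronPow A zero    []      []      = ∑-tuples-zero q (λ x → kronPow A zero x [] * kronPow A zero x [])
    gram-kronPow A (suc n) (a ∷ y) (b ∷ z) = begin
      ∑[ x ∈ tuples q (suc n) ] kronPow A (suc n) x (a ∷ y) * kronPow A (suc n) x (b ∷ z)
        ≡⟨ ∑-tuples-suc q n _ ⟩
      ∑[ c ∈ allFin q ] ∑[ x ∈ tuples q n ] A c a * kronPow A n x y * (A c b * kronPow A n x z)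
        ≡⟨ ∑-cong (allFin q) (λ c → trans (∑-cong (tuples q n) (λ x → interchange (A c a) _ (A c b) _))
                                          (sym (*-distribˡ-∑ (tuples q n) (A c a * A c b) _))) ⟩
      ∑[ c ∈ allFin q ] A c a * A c b * gram (tuples q n) (kronPow A n) y z
        ≡⟨ ∑-cong (allFin q) (λ c → cong (A c a * A c b *_) (gram-kronPow A n y z)) ⟩
      ∑[ c ∈ allFin q ] A c a * A c b * kronPow (gram (allFin q) A) n y z
        ≡⟨ sym (*-distribʳ-∑ (allFin q) _ (λ c → A c a * A c b)) ⟩
      gram (allFin q) A a b * kronPow (gram (allFin q) A) n y z ∎

    ℓ₁-kronPow : ∀ (B : Fin q → Fin q → ℤ) n → ℓ₁ (tuples q n) (kronPow B n) ≡ ℓ₁ (allFin q) B ^ n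
    ℓ₁-kronPow B zero    = refl
    ℓ₁-kronPow B (suc n) = begin
      ℓ₁ (tuples q (suc n)) (kronPow B (suc n))
        ≡⟨ ∑-tuples-suc q n _ ⟩
      ∑[ a ∈ allFin q ] ∑[ y ∈ tuples q n ] ∑[ z ∈ tuples q (suc n) ] + ∣ kronPow B (suc n) (a ∷ y) z ∣
        ≡⟨ ∑-cong (allFin q) (λ a → ∑-cong (tuples q n) (λ y → ∑-tuples-suc q n _)) ⟩
      ∑[ a ∈ allFin q ] ∑[ y ∈ tuples q n ] ∑[ b ∈ allFin q ] ∑[ z ∈ tuples q n ] + ∣ B a b * kronPow B n y z ∣
        ≡⟨ ∑-cong (allFin q) (λ a → ∑-comm (tuples q n) (allFin q) _) ⟩
      ∑[ a ∈ allFin q ] ∑[ b ∈ allFin q ] ∑[ y ∈ tuples q n ] ∑[ z ∈ tuples q n ] + ∣ B a b * kronPow B n y z ∣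
        ≡⟨ ∑-cong (allFin q) (λ a → ∑-cong (allFin q) (λ b → ∑-cong (tuples q n) (λ y → ∑-cong (tuples q n) (λ z →
             trans (cong +_ (ℤ.abs-* (B a b) _)) (ℤ.pos-* ∣ B a b ∣ _))))) ⟩
      ∑[ a ∈ allFin q ] ∑[ b ∈ allFin q ] ∑[ y ∈ tuples q n ] ∑[ z ∈ tuples q n ] + ∣ B a b ∣ * + ∣ kronPow B n y z ∣
        ≡⟨ ∑∑-*-∑∑ (allFin q) (tuples q n) _ _ ⟩
      ℓ₁ (allFin q) B * ℓ₁ (tuples q n) (kronPow B n)
        ≡⟨ cong (ℓ₁ (allFin q) B *_) (ℓ₁-kronPow B n) ⟩
      ℓ₁ (allFin q) B ^ suc n ∎

open Gram

module CauchySchwarz where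

  open import Data.Integer using (ℤ; +_; _+_; _-_; _*_; _≤_; 0ℤ; 1ℤ)
  import Data.Integer.Properties as ℤ
  open import Data.Integer.Tactic.RingSolver using (solve-∀)
  open import Data.List using (List; []; _∷_; length)
  open import Relation.Binary.PropositionalEquality using (_≡_; sym; cong; cong₂; subst; module ≡-Reasoning)

  sign-am-gm : ∀ α β {s} → IsSign s → ∀ w → + 2 * α * β * (s * w) ≤ α * α + β * β * (w * w)
  sign-am-gm α β {s} s± w = ℤ.0≤i-j⇒j≤i (subst (0ℤ ≤_) square (0≤i*i (α * s - β * w)))
    where
    open ≡-Reasoning
    expand : ∀ α β s w → (α * s - β * w) * (α * s - β * w)
                         ≡ α * α * (s * s) + β * β * (w * w) - + 2 * α * β * (s * w)
    expand = solve-∀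
    square : (α * s - β * w) * (α * s - β * w) ≡ α * α + β * β * (w * w) - + 2 * α * β * (s * w)
    square = begin
      (α * s - β * w) * (α * s - β * w)
        ≡⟨ expand α β s w ⟩
      α * α * (s * s) + β * β * (w * w) - + 2 * α * β * (s * w)
        ≡⟨ cong (λ x → α * α * x + β * β * (w * w) - + 2 * α * β * (s * w)) (sign-sq s±) ⟩
      α * α * 1ℤ + β * β * (w * w) - + 2 * α * β * (s * w)
        ≡⟨ cong (λ x → x + β * β * (w * w) - + 2 * α * β * (s * w)) (ℤ.*-identityʳ (α * α)) ⟩
      α * α + β * β * (w * w) - + 2 * α * β * (s * w) ∎

  sign-cauchy-schwarz : ∀ {I : Set} (xs : List I) {s : I → ℤ} → (∀ i → IsSign (s i)) → ∀ (w : I → ℤ) →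
    (∑[ i ∈ xs ] s i * w i) * (∑[ i ∈ xs ] s i * w i) ≤ + length xs * (∑[ i ∈ xs ] w i * w i)
  sign-cauchy-schwarz []          s± w = ℤ.≤-refl
  sign-cauchy-schwarz xs@(_ ∷ _) {s} s± w =
    ℤ.*-cancelˡ-≤-pos (S * S) (K * Z) K (+-cancelˡ-≤ (K * (S * S)) (begin
      K * (S * S) + K * (S * S)                 ≡⟨ double K S ⟩
      + 2 * S * K * S                           ≡⟨ *-distribˡ-∑ xs (+ 2 * S * K) _ ⟩
      ∑[ i ∈ xs ] + 2 * S * K * (s i * w i)     ≤⟨ ∑-mono-≤ xs (λ i → sign-am-gm S K (s± i) (w i)) ⟩
      ∑[ i ∈ xs ] (S * S + K * K * (w i * w i)) ≡⟨ ∑-distrib-+ xs (λ _ → S * S) (λ i → K * K * (w i * w i)) ⟩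
      (∑[ i ∈ xs ] S * S) + (∑[ i ∈ xs ] K * K * (w i * w i))
        ≡⟨ cong₂ _+_ (∑-const xs (S * S)) (sym (*-distribˡ-∑ xs (K * K) (λ i → w i * w i))) ⟩
      K * (S * S) + K * K * Z                   ≡⟨ cong (_+_ (K * (S * S))) (ℤ.*-assoc K K Z) ⟩
      K * (S * S) + K * (K * Z)                 ∎))
    where
    open ℤ.≤-Reasoning
    K S Z : ℤ
    K = + length xs
    S = ∑[ i ∈ xs ] s i * w i
    Z = ∑[ i ∈ xs ] w i * w i
    double : ∀ K S → K * (S * S) + K * (S * S) ≡ + 2 * S * K * S
    double = solve-∀

open CauchySchwarz

module LowRankCorrelation where

  open import Data.Nat as ℕ using (ℕ; _^_)
  open import Data.Integer using (ℤ; +_; _*_; _≤_)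
  import Data.Integer.Properties as ℤ
  open import Data.Integer.Tactic.RingSolver using (solve-∀)
  open import Data.Fin using (Fin)
  open import Data.Vec using (Vec)
  open import Data.List using (List; length; cartesianProduct)
  open import Data.Product using (_×_; _,_)
  open import Relation.Binary.PropositionalEquality using (_≡_; sym; trans; cong; cong₂; module ≡-Reasoning)

  module _ {I : Set} (X : List I) {k r : ℕ} (M : I → I → ℤ) (label : I → Vec (Fin k) r) where

    private
      R : List (Vec (Fin k) r)
      R = tuples k r
      Δ : Vec (Fin k) r → Vec (Fin k) r → ℤ
      Δ = kronPow δ r

    labelledRowSum : Vec (Fin k) r → I → ℤ
    labelledRowSum v x = ∑[ y ∈ X ] Δ (label y) v * M x y

    correlation-by-labels : (h : I → Vec (Fin k) r → ℤ) →
      ∑[ x ∈ X ] ∑[ y ∈ X ] M x y * h x (label y) ≡ ∑[ x ∈ X ] ∑[ v ∈ R ] h x v * labelledRowSum v x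
    correlation-by-labels h = ∑-cong X λ x → begin
      ∑[ y ∈ X ] M x y * h x (label y)
        ≡⟨ ∑-cong X (λ y → cong (M x y *_) (∑-kronPow-δ r (label y) (h x))) ⟨
      ∑[ y ∈ X ] M x y * (∑[ v ∈ R ] Δ (label y) v * h x v)   ≡⟨ ∑-cong X (λ y → *-distribˡ-∑ R (M x y) _) ⟩
      ∑[ y ∈ X ] ∑[ v ∈ R ] M x y * (Δ (label y) v * h x v)   ≡⟨ ∑-comm X R _ ⟩
      ∑[ v ∈ R ] ∑[ y ∈ X ] M x y * (Δ (label y) v * h x v)
        ≡⟨ ∑-cong R (λ v → trans (∑-cong X (λ y → rotate (M x y) (Δ (label y) v) (h x v))) (sym (*-distribˡ-∑ X (h x v) _))) ⟩
      ∑[ v ∈ R ] h x v * labelledRowSum v x                       ∎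
      where
      open ≡-Reasoning
      rotate : ∀ m d e → m * (d * e) ≡ e * (d * m)
      rotate = solve-∀

    rowEnergy : ∀ x → ∑[ v ∈ R ] labelledRowSum v x * labelledRowSum v x
                      ≡ ∑[ y ∈ X ] ∑[ z ∈ X ] Δ (label z) (label y) * (M x y * M x z)
    rowEnergy x = begin
      ∑[ v ∈ R ] labelledRowSum v x * labelledRowSum v x
        ≡⟨ ∑-cong R (λ v → *-distribʳ-∑ X (labelledRowSum v x) _) ⟩
      ∑[ v ∈ R ] ∑[ y ∈ X ] Δ (label y) v * M x y * labelledRowSum v x
        ≡⟨ ∑-comm R X _ ⟩
      ∑[ y ∈ X ] ∑[ v ∈ R ] Δ (label y) v * M x y * labelledRowSum v x
        ≡⟨ ∑-cong X (λ y → trans (∑-cong R (λ v → swap (Δ (label y) v) (M x y) (labelledRowSum v x)))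
                                 (sym (*-distribˡ-∑ R (M x y) _))) ⟩
      ∑[ y ∈ X ] M x y * (∑[ v ∈ R ] Δ (label y) v * labelledRowSum v x)
        ≡⟨ ∑-cong X (λ y → cong (M x y *_) (∑-kronPow-δ r (label y) (λ v → labelledRowSum v x))) ⟩
      ∑[ y ∈ X ] M x y * labelledRowSum (label y) x
        ≡⟨ ∑-cong X (λ y → trans (*-distribˡ-∑ X (M x y) _) (∑-cong X (λ z → rotate (M x y) (Δ (label z) (label y)) (M x z)))) ⟩
      ∑[ y ∈ X ] ∑[ z ∈ X ] Δ (label z) (label y) * (M x y * M x z) ∎
      where
      open ≡-Reasoning
      swap : ∀ d m c → d * m * c ≡ m * (d * c)
      swap = solve-∀
      rotate : ∀ m d n → m * (d * n) ≡ d * (m * n)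
      rotate = solve-∀

    energy : ∑[ x ∈ X ] ∑[ v ∈ R ] labelledRowSum v x * labelledRowSum v x
             ≡ ∑[ y ∈ X ] ∑[ z ∈ X ] Δ (label z) (label y) * gram X M y z
    energy = begin
      ∑[ x ∈ X ] ∑[ v ∈ R ] labelledRowSum v x * labelledRowSum v x
        ≡⟨ ∑-cong X rowEnergy ⟩
      ∑[ x ∈ X ] ∑[ y ∈ X ] ∑[ z ∈ X ] Δ (label z) (label y) * (M x y * M x z)
        ≡⟨ ∑-comm X X _ ⟩
      ∑[ y ∈ X ] ∑[ x ∈ X ] ∑[ z ∈ X ] Δ (label z) (label y) * (M x y * M x z)
        ≡⟨ ∑-cong X (λ y → ∑-comm X X _) ⟩
      ∑[ y ∈ X ] ∑[ z ∈ X ] ∑[ x ∈ X ] Δ (label z) (label y) * (M x y * M x z)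
        ≡⟨ ∑-cong X (λ y → ∑-cong X (λ z → sym (*-distribˡ-∑ X (Δ (label z) (label y)) _))) ⟩
      ∑[ y ∈ X ] ∑[ z ∈ X ] Δ (label z) (label y) * gram X M y z ∎
      where open ≡-Reasoning

    low-rank-correlation : (h : I → Vec (Fin k) r → ℤ) → (∀ x v → IsSign (h x v)) →
      let corr = ∑[ x ∈ X ] ∑[ y ∈ X ] M x y * h x (label y) in
      corr * corr ≤ + (length X ℕ.* k ^ r) * ℓ₁ X (gram X M)
    low-rank-correlation h h± = begin
      corr * corr
        ≡⟨ cong (λ c → c * c) (trans (correlation-by-labels h) flatten) ⟩
      (∑ XR (λ (x , v) → h x v * labelledRowSum v x)) * (∑ XR (λ (x , v) → h x v * labelledRowSum v x))
        ≤⟨ sign-cauchy-schwarz XR (λ (x , v) → h± x v) (λ (x , v) → labelledRowSum v x) ⟩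
      + length XR * (∑ XR (λ (x , v) → labelledRowSum v x * labelledRowSum v x))
        ≡⟨ cong₂ _*_ (cong +_ |XR|) (trans (sym flatten) energy) ⟩
      + (length X ℕ.* k ^ r) * (∑[ y ∈ X ] ∑[ z ∈ X ] Δ (label z) (label y) * gram X M y z)
        ≤⟨ ℤ.*-monoˡ-≤-nonNeg (+ (length X ℕ.* k ^ r))
             (∑-mono-≤ X (λ y → ∑-mono-≤ X (λ z → bit-*-≤-∣∣ (kronPow-δ-bit r (label z) (label y)) _))) ⟩
      + (length X ℕ.* k ^ r) * ℓ₁ X (gram X M) ∎
      where
      open ℤ.≤-Reasoning
      corr : ℤ
      corr = ∑[ x ∈ X ] ∑[ y ∈ X ] M x y * h x (label y)
      XR : List (I × Vec (Fin k) r)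
      XR = cartesianProduct X R
      flatten : ∀ {F : I → Vec (Fin k) r → ℤ} → ∑[ x ∈ X ] ∑[ v ∈ R ] F x v ≡ ∑ XR (λ (x , v) → F x v)
      flatten {F} = sym (∑-cartesianProductWith _,_ X R (λ (x , v) → F x v))
      |XR| : length XR ≡ length X ℕ.* k ^ r
      |XR| = trans (length-cartesianProductWith _,_ X R) (cong (length X ℕ.*_) (length-tuples k r))

open LowRankCorrelation

module Mismatches where

  open import Data.Nat as ℕ using (ℕ)
  open import Data.Integer using (ℤ; +_; _+_; _*_; 1ℤ)
  import Data.Integer.Properties as ℤ
  open import Data.Fin using (Fin; toℕ)
  open import Data.Vec using (Vec)
  open import Data.List using (List; length)
  open import Data.Sum using (inj₁; inj₂)
  open import Relation.Nullary using (yes; no)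
  open import Relation.Binary.PropositionalEquality using (_≡_; refl; sym; trans; cong; module ≡-Reasoning)
  open ≡-Reasoning

  -- The summand of mismatches (0 if a = bool ℓ, 1 otherwise), obtained as the mismatch count of
  -- the 1×1 case n = 0 because mismatches keeps its summand local.
  entryMismatch : ∀ {p} → ℤ → Fin p → ℕ
  entryMismatch {p} a ℓ = mismatches {p} {1} 0 (λ _ _ → a) (λ _ _ → ℓ)

  entryMismatch-sign : ∀ {p a} → IsSign a → (ℓ : Fin p) → + 2 * + entryMismatch a ℓ + a * boolF ℓ ≡ 1ℤ
  entryMismatch-sign (inj₁ refl) ℓ with toℕ ℓ ℕ.≟ 1
  ... | yes _ = refl
  ... | no  _ = refl
  entryMismatch-sign (inj₂ refl) ℓ with toℕ ℓ ℕ.≟ 1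
  ... | yes _ = refl
  ... | no  _ = refl

  mismatches-∑ : ∀ {p q} n (M : Vec (Fin q) n → Vec (Fin q) n → ℤ) (L : Vec (Fin q) n → Vec (Fin q) n → Fin p) →
    + mismatches n M L ≡ ∑[ x ∈ tuples q n ] ∑[ y ∈ tuples q n ] + entryMismatch (M x y) (L x y)
  mismatches-∑ {q = q} n M L =
    trans (sumTuples-∑ q n _) (∑-cong (tuples q n) (λ x → sumTuples-∑ q n (λ y → entryMismatch (M x y) (L x y))))

  mismatches+correlation : ∀ {p} {I : Set} (X : List I) (M : I → I → ℤ) (L : I → I → Fin p) →
    (∀ x y → IsSign (M x y)) →
    + 2 * (∑[ x ∈ X ] ∑[ y ∈ X ] + entryMismatch (M x y) (L x y)) + (∑[ x ∈ X ] ∑[ y ∈ X ] M x y * boolF (L x y))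
    ≡ + length X * + length X
  mismatches+correlation {I = I} X M L M± = begin
    + 2 * (∑[ x ∈ X ] ∑[ y ∈ X ] e x y) + (∑[ x ∈ X ] ∑[ y ∈ X ] c x y)
      ≡⟨ cong (_+ (∑[ x ∈ X ] ∑[ y ∈ X ] c x y)) (trans (*-distribˡ-∑ X (+ 2) _) (∑-cong X (λ x → *-distribˡ-∑ X (+ 2) (e x)))) ⟩
    (∑[ x ∈ X ] ∑[ y ∈ X ] + 2 * e x y) + (∑[ x ∈ X ] ∑[ y ∈ X ] c x y)
      ≡⟨ ∑-distrib-+ X (λ x → ∑[ y ∈ X ] + 2 * e x y) (λ x → ∑[ y ∈ X ] c x y) ⟨
    ∑[ x ∈ X ] ((∑[ y ∈ X ] + 2 * e x y) + (∑[ y ∈ X ] c x y))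
      ≡⟨ ∑-cong X (λ x → sym (∑-distrib-+ X (λ y → + 2 * e x y) (c x))) ⟩
    ∑[ x ∈ X ] ∑[ y ∈ X ] (+ 2 * e x y + c x y)
      ≡⟨ ∑-cong X (λ x → ∑-cong X (λ y → entryMismatch-sign (M± x y) (L x y))) ⟩
    ∑[ x ∈ X ] ∑[ y ∈ X ] 1ℤ
      ≡⟨ trans (∑-cong X (λ x → trans (∑-const X 1ℤ) (ℤ.*-identityʳ _))) (∑-const X _) ⟩
    + length X * + length X ∎
    where
    e : I → I → ℤ
    e x y = + entryMismatch (M x y) (L x y)
    c : I → I → ℤ
    c x y = M x y * boolF (L x y)

open Mismatches

module RationalEmbedding where

  open import Data.Nat as ℕ using (suc; NonZero)
  open import Data.Integer as ℤ using (ℤ; +_)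
  import Data.Integer.Properties as ℤ
  open import Data.Integer.Tactic.RingSolver using (solve-∀)
  open import Data.Rational using (ℚ; _/_; toℚᵘ; _+_; _*_; _≤_)
  import Data.Rational.Properties as ℚ
  open import Data.Rational.Unnormalised as ℚᵘ using (mkℚᵘ; *≡*; *≤*; _≃_)
  import Data.Rational.Unnormalised.Properties as ℚᵘ
  open import Relation.Binary.PropositionalEquality using (_≡_; trans; cong; subst₂)

  ι : ℤ → ℚ
  ι i = i / 1

  private
    toℚᵘ-/ : ∀ i d → toℚᵘ (i / suc d) ≃ mkℚᵘ i d
    toℚᵘ-/ i d = ℚ.toℚᵘ-fromℚᵘ (mkℚᵘ i d)

  ι-+ : ∀ i j → ι (i ℤ.+ j) ≡ ι i + ι j
  ι-+ i j = ℚ.toℚᵘ-injective (begin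
    toℚᵘ (ι (i ℤ.+ j))             ≈⟨ toℚᵘ-/ (i ℤ.+ j) 0 ⟩
    mkℚᵘ (i ℤ.+ j) 0               ≈⟨ *≡* (eq i j) ⟩
    mkℚᵘ i 0 ℚᵘ.+ mkℚᵘ j 0         ≈⟨ ℚᵘ.+-cong (toℚᵘ-/ i 0) (toℚᵘ-/ j 0) ⟨
    toℚᵘ (ι i) ℚᵘ.+ toℚᵘ (ι j)     ≈⟨ ℚ.toℚᵘ-homo-+ (ι i) (ι j) ⟨
    toℚᵘ (ι i + ι j)               ∎)
    where
    open ℚᵘ.≃-Reasoning
    eq : ∀ i j → (i ℤ.+ j) ℤ.* + 1 ≡ (i ℤ.* + 1 ℤ.+ j ℤ.* + 1) ℤ.* + 1
    eq = solve-∀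

  ι-* : ∀ i j → ι (i ℤ.* j) ≡ ι i * ι j
  ι-* i j = ℚ.toℚᵘ-injective (begin
    toℚᵘ (ι (i ℤ.* j))             ≈⟨ toℚᵘ-/ (i ℤ.* j) 0 ⟩
    mkℚᵘ (i ℤ.* j) 0               ≈⟨ ℚᵘ.*-cong (toℚᵘ-/ i 0) (toℚᵘ-/ j 0) ⟨
    toℚᵘ (ι i) ℚᵘ.* toℚᵘ (ι j)     ≈⟨ ℚ.toℚᵘ-homo-* (ι i) (ι j) ⟨
    toℚᵘ (ι i * ι j)               ∎)
    where open ℚᵘ.≃-Reasoning

  ι-mono-≤ : ∀ {i j} → i ℤ.≤ j → ι i ≤ ι j
  ι-mono-≤ {i} {j} i≤j = ℚ.toℚᵘ-cancel-≤ (ℚᵘ.≤-respˡ-≃ (ℚᵘ.≃-sym (toℚᵘ-/ i 0))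
    (ℚᵘ.≤-respʳ-≃ (ℚᵘ.≃-sym (toℚᵘ-/ j 0)) (*≤* (ℤ.*-monoʳ-≤-nonNeg (+ 1) i≤j))))

  ι-cancel-≤ : ∀ {i j} → ι i ≤ ι j → i ℤ.≤ j
  ι-cancel-≤ {i} {j} ιi≤ιj
    with ℚᵘ.≤-respˡ-≃ (toℚᵘ-/ i 0) (ℚᵘ.≤-respʳ-≃ (toℚᵘ-/ j 0) (ℚ.toℚᵘ-mono-≤ ιi≤ιj))
  ... | *≤* i*1≤j*1 = subst₂ ℤ._≤_ (ℤ.*-identityʳ i) (ℤ.*-identityʳ j) i*1≤j*1

  ι-*-/ : ∀ i d .{{_ : NonZero d}} → ι (+ d) * (i / d) ≡ ι i
  ι-*-/ i (suc d) = ℚ.toℚᵘ-injective (begin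
    toℚᵘ (ι (+ suc d) * (i / suc d))            ≈⟨ ℚ.toℚᵘ-homo-* (ι (+ suc d)) (i / suc d) ⟩
    toℚᵘ (ι (+ suc d)) ℚᵘ.* toℚᵘ (i / suc d)    ≈⟨ ℚᵘ.*-cong (toℚᵘ-/ (+ suc d) 0) (toℚᵘ-/ i d) ⟩
    mkℚᵘ (+ suc d) 0 ℚᵘ.* mkℚᵘ i d             ≈⟨ *≡* (eq (+ suc d) i) ⟩
    mkℚᵘ i 0                                    ≈⟨ toℚᵘ-/ i 0 ⟨
    toℚᵘ (ι i)                                  ∎)
    where
    open ℚᵘ.≃-Reasoning
    eq : ∀ D i → D ℤ.* i ℤ.* + 1 ≡ i ℤ.* (+ 1 ℤ.* D)
    eq = solve-∀

  ℕtoℚ-+ : ∀ m n → ℕtoℚ (m ℕ.+ n) ≡ ℕtoℚ m + ℕtoℚ n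
  ℕtoℚ-+ m n = trans (cong ι (ℤ.pos-+ m n)) (ι-+ (+ m) (+ n))

  ℕtoℚ-* : ∀ m n → ℕtoℚ (m ℕ.* n) ≡ ℕtoℚ m * ℕtoℚ n
  ℕtoℚ-* m n = trans (cong ι (ℤ.pos-* m n)) (ι-* (+ m) (+ n))

  ℕtoℚ-mono-≤ : ∀ {m n} → m ℕ.≤ n → ℕtoℚ m ≤ ℕtoℚ n
  ℕtoℚ-mono-≤ m≤n = ι-mono-≤ (ℤ.+≤+ m≤n)

  ℕtoℚ-cancel-≤ : ∀ {m n} → ℕtoℚ m ≤ ℕtoℚ n → m ℕ.≤ n
  ℕtoℚ-cancel-≤ ιm≤ιn = ℤ.drop‿+≤+ (ι-cancel-≤ ιm≤ιn)

open RationalEmbedding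

module NonRankOne where

  open import Data.Nat as ℕ using (ℕ; suc)
  open import Data.Integer using (ℤ; +_; _+_; _*_; _≤_; _≟_; 1ℤ; ∣_∣)
  import Data.Integer.Properties as ℤ
  open import Data.Fin using (Fin; zero)
  open import Data.Fin.Properties using (all?; ¬∀⟶∃¬)
  open import Data.List using (allFin)
  open import Data.List.Membership.Propositional.Properties using (∈-allFin)
  open import Data.Product using (Σ-syntax; _,_)
  open import Data.Sum using (inj₁; inj₂)
  open import Data.Empty using (⊥-elim)
  open import Relation.Nullary using (¬_; yes; no)
  open import Relation.Binary.PropositionalEquality using (_≡_; _≢_; trans; cong; subst; module ≡-Reasoning)

  module _ {q : ℕ} {A : Fin q → Fin q → ℤ} (A± : IsSignMatrix A) where

    private
      G : Fin q → Fin q → ℤ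
      G = gram (allFin q) A
      products± : ∀ a b c → IsSign (A c a * A c b)
      products± a b c = sign-* (A± c a) (A± c b)

    ∣gram∣≤ : ∀ a b → + ∣ G a b ∣ ≤ + q
    ∣gram∣≤ a b = subst (λ n → + ∣ G a b ∣ ≤ + n) (length-allFin q) (∣∑signs∣≤length (allFin q) (products± a b))

    ∣gram∣+2≤ : ∀ {a b c d} → A c a * A c b ≢ A d a * A d b → + ∣ G a b ∣ + + 2 ≤ + q
    ∣gram∣+2≤ {a} {b} {c} {d} c≁d with distinct-signs (products± a b c) (products± a b d) c≁d
    ... | inj₁ (c↦1 , d↦-1) = subst (λ n → + ∣ G a b ∣ + + 2 ≤ + n) (length-allFin q)
      (∣∑signs∣+2≤length (allFin q) (products± a b) (∈-allFin c) (∈-allFin d) c↦1 d↦-1)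
    ... | inj₂ (c↦-1 , d↦1) = subst (λ n → + ∣ G a b ∣ + + 2 ≤ + n) (length-allFin q)
      (∣∑signs∣+2≤length (allFin q) (products± a b) (∈-allFin d) (∈-allFin c) d↦1 c↦-1)

    ℓ₁-gram+2≤ : ∀ {a b c d} → A c a * A c b ≢ A d a * A d b → ℓ₁ (allFin q) G + + 2 ≤ + (q ℕ.* (q ℕ.* q))
    ℓ₁-gram+2≤ {a} {b} c≁d = begin
      ℓ₁ (allFin q) G + + 2            ≤⟨ ∑-mono-≤-gap (allFin q) (+ 2) row≤ (∈-allFin a) row-a+2≤ ⟩
      ∑[ a′ ∈ allFin q ] + q * + q     ≡⟨ ∑-allFin-const q (+ q * + q) ⟩
      + q * (+ q * + q)                ≡⟨ trans (ℤ.pos-* q (q ℕ.* q)) (cong (+ q *_) (ℤ.pos-* q q)) ⟨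
      + (q ℕ.* (q ℕ.* q))              ∎
      where
      open ℤ.≤-Reasoning
      row≤ : ∀ a′ → ∑[ b′ ∈ allFin q ] + ∣ G a′ b′ ∣ ≤ + q * + q
      row≤ a′ = subst ((∑[ b′ ∈ allFin q ] + ∣ G a′ b′ ∣) ≤_) (∑-allFin-const q (+ q))
        (∑-mono-≤ (allFin q) (∣gram∣≤ a′))
      row-a+2≤ : (∑[ b′ ∈ allFin q ] + ∣ G a b′ ∣) + + 2 ≤ + q * + q
      row-a+2≤ = subst ((∑[ b′ ∈ allFin q ] + ∣ G a b′ ∣) + + 2 ≤_) (∑-allFin-const q (+ q))
        (∑-mono-≤-gap (allFin q) (+ 2) (∣gram∣≤ a) (∈-allFin b) (∣gram∣+2≤ c≁d))

  mixed-columns : ∀ {q} {A : Fin (suc q) → Fin (suc q) → ℤ} → IsSignMatrix A → ¬ RankℚAtMostOne A →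
                  Σ[ b ∈ Fin (suc q) ] Σ[ c ∈ Fin (suc q) ] A c zero * A c b ≢ A zero zero * A zero b
  mixed-columns {q} {A} A± ¬rank≤1 with all? (λ b → all? (λ c → A c zero * A c b ≟ A zero zero * A zero b))
  ... | yes proportional = ⊥-elim (¬rank≤1 ((λ c → ι (A c zero)) , (λ b → ι (A zero zero * A zero b)) ,
                                             λ c b → trans (cong ι (entry b c)) (ι-* (A c zero) (A zero zero * A zero b))))
    where
    entry : ∀ b c → A c b ≡ A c zero * (A zero zero * A zero b)
    entry b c = begin
      A c b                           ≡⟨ ℤ.*-identityˡ (A c b) ⟨
      1ℤ * A c b                      ≡⟨ cong (_* A c b) (sign-sq (A± c zero)) ⟨
      A c zero * A c zero * A c b     ≡⟨ ℤ.*-assoc (A c zero) (A c zero) (A c b) ⟩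
      A c zero * (A c zero * A c b)   ≡⟨ cong (A c zero *_) (proportional b c) ⟩
      A c zero * (A zero zero * A zero b) ∎
      where open ≡-Reasoning
  ... | no ¬proportional with ¬∀⟶∃¬ _ _ (λ b → all? (λ c → A c zero * A c b ≟ A zero zero * A zero b)) ¬proportional
  ... | b , ¬b-proportional with ¬∀⟶∃¬ _ _ (λ c → A c zero * A c b ≟ A zero zero * A zero b) ¬b-proportional
  ... | c , c≁0 = b , c , c≁0

open NonRankOne

module KroneckerPowerRigidity where

  open import Data.Nat as ℕ using (ℕ; NonZero; _^_; z≤n)
  import Data.Nat.Properties as ℕ
  open import Data.Nat.DivMod using (_mod_)
  open import Data.Integer using (ℤ; +_; _+_; _*_; _≤_; +≤+; ∣_∣) renaming (_^_ to _^ᶻ_)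
  import Data.Integer.Properties as ℤ
  open import Data.Fin using (Fin; toℕ)
  open import Data.Vec using (Vec; tabulate; lookup)
  open import Data.Vec.Properties using (lookup∘tabulate)
  open import Data.List using (List; allFin; length)
  open import Data.Product using (_,_)
  open import Relation.Binary.PropositionalEquality using (_≡_; _≢_; sym; trans; cong; cong₂; subst)

  column : ∀ {I : Set} {p r} → (Fin r → I → Fin p) → I → Vec (Fin p) r
  column V y = tabulate (λ k → V k y)

  boolForm : ∀ p .{{_ : NonZero p}} {I : Set} {r} → (I → Fin r → Fin p) → I → Vec (Fin p) r → ℤ
  boolForm p {r = r} U x v = boolF {p} ((sumFin r (λ k → toℕ (U x k) ℕ.* toℕ (lookup v k))) mod p)

  boolF-factorization : ∀ p .{{_ : NonZero p}} {I : Set} {r}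
    (L : I → I → Fin p) (U : I → Fin r → Fin p) (V : Fin r → I → Fin p) →
    (∀ x y → L x y ≡ (sumFin r (λ k → toℕ (U x k) ℕ.* toℕ (V k y))) mod p) →
    ∀ x y → boolF (L x y) ≡ boolForm p U x (column V y)
  boolF-factorization p {r = r} L U V L≡UV x y = cong boolF (trans (L≡UV x y) (cong (_mod p)
    (sumFin-cong r (λ k → cong (λ ℓ → toℕ (U x k) ℕ.* toℕ ℓ) (sym (lookup∘tabulate (λ k → V k y) k))))))

  gramNorm : ∀ {q} → (Fin q → Fin q → ℤ) → ℕ
  gramNorm {q} A = ∣ ℓ₁ (allFin q) (gram (allFin q) A) ∣

  +gramNorm : ∀ {q} (A : Fin q → Fin q → ℤ) → + gramNorm A ≡ ℓ₁ (allFin q) (gram (allFin q) A)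
  +gramNorm {q} A = ℤ.0≤i⇒+∣i∣≡i (∑-nonNeg (allFin q) (λ a → ∑-nonNeg (allFin q) (λ b → +≤+ z≤n)))

  module _ {q : ℕ} {A : Fin q → Fin q → ℤ} (A± : IsSignMatrix A) where

    gramNorm+2≤ : ∀ {a b c d} → A c a * A c b ≢ A d a * A d b → 2 ℕ.+ gramNorm A ℕ.≤ q ℕ.* (q ℕ.* q)
    gramNorm+2≤ c≁d = subst (ℕ._≤ q ℕ.* (q ℕ.* q)) (ℕ.+-comm (gramNorm A) 2)
      (ℤ.drop‿+≤+ (subst (λ e → e + + 2 ≤ + (q ℕ.* (q ℕ.* q))) (sym (+gramNorm A)) (ℓ₁-gram+2≤ A± c≁d)))

    module _ (p : ℕ) .{{_ : NonZero p}} (n r : ℕ) (L : Vec (Fin q) n → Vec (Fin q) n → Fin p) where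

      private
        X : List (Vec (Fin q) n)
        X = tuples q n
        M : Vec (Fin q) n → Vec (Fin q) n → ℤ
        M = kronPow A n

      correlation : ℤ
      correlation = ∑[ x ∈ X ] ∑[ y ∈ X ] M x y * boolF (L x y)

      mismatches-lower-bound : q ^ n ℕ.* q ^ n ℕ.≤ 2 ℕ.* mismatches n M L ℕ.+ ∣ correlation ∣
      mismatches-lower-bound = ℤ.drop‿+≤+ (begin
        + (q ^ n ℕ.* q ^ n)
          ≡⟨ trans (ℤ.pos-* (q ^ n) (q ^ n)) (cong (λ l → + l * + l) (sym (length-tuples q n))) ⟩
        + length X * + length X
          ≡⟨ mismatches+correlation X M L (kronPow-sign A± n) ⟨
        + 2 * (∑[ x ∈ X ] ∑[ y ∈ X ] + entryMismatch (M x y) (L x y)) + correlation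
          ≡⟨ cong (λ m → + 2 * m + correlation) (mismatches-∑ n M L) ⟨
        + 2 * + mismatches n M L + correlation
          ≤⟨ ℤ.+-monoʳ-≤ (+ 2 * + mismatches n M L) (i≤+∣i∣ correlation) ⟩
        + 2 * + mismatches n M L + + ∣ correlation ∣
          ≡⟨ trans (ℤ.pos-+ (2 ℕ.* mismatches n M L) ∣ correlation ∣) (cong (_+ + ∣ correlation ∣) (ℤ.pos-* 2 (mismatches n M L))) ⟨
        + (2 ℕ.* mismatches n M L ℕ.+ ∣ correlation ∣) ∎)
        where open ℤ.≤-Reasoning

      correlation² : RankFpAtMost p L r →
                     ∣ correlation ∣ ℕ.* ∣ correlation ∣ ℕ.≤ q ^ n ℕ.* p ^ r ℕ.* gramNorm A ^ n
      correlation² (U , V , L≡UV) = ℤ.drop‿+≤+ (begin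
        + (∣ correlation ∣ ℕ.* ∣ correlation ∣)
          ≡⟨ +[∣i∣*∣i∣]≡i*i correlation ⟩
        correlation * correlation
          ≡⟨ cong (λ c → c * c) (∑-cong X (λ x → ∑-cong X (λ y → cong (M x y *_) (boolF-factorization p L U V L≡UV x y)))) ⟩
        correlationᵁⱽ * correlationᵁⱽ
          ≤⟨ low-rank-correlation X M (column V) (boolForm p U) (λ x v → boolF-sign _) ⟩
        + (length X ℕ.* p ^ r) * ℓ₁ X (gram X M)
          ≡⟨ cong₂ (λ l e → + (l ℕ.* p ^ r) * e) (length-tuples q n)
               (trans (∑-cong X (λ y → ∑-cong X (λ z → cong (λ e → + ∣ e ∣) (gram-kronPow A n y z)))) (ℓ₁-kronPow _ n)) ⟩
        + (q ^ n ℕ.* p ^ r) * ℓ₁ (allFin q) (gram (allFin q) A) ^ᶻ n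
          ≡⟨ cong (λ e → + (q ^ n ℕ.* p ^ r) * e ^ᶻ n) (+gramNorm A) ⟨
        + (q ^ n ℕ.* p ^ r) * (+ gramNorm A) ^ᶻ n
          ≡⟨ trans (ℤ.pos-* (q ^ n ℕ.* p ^ r) (gramNorm A ^ n)) (cong (+ (q ^ n ℕ.* p ^ r) *_) (pos-^ (gramNorm A) n)) ⟨
        + (q ^ n ℕ.* p ^ r ℕ.* gramNorm A ^ n) ∎)
        where
        open ℤ.≤-Reasoning
        correlationᵁⱽ : ℤ
        correlationᵁⱽ = ∑[ x ∈ X ] ∑[ y ∈ X ] M x y * boolForm p U x (column V y)

open KroneckerPowerRigidity

module Arithmetic where

  open import Data.Nat using (ℕ; zero; suc; NonZero; _+_; _*_; _^_; _∸_; _≤_)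
  open import Data.Nat.Properties
  open import Data.Nat.Tactic.RingSolver using (solve-∀)
  open import Algebra.Properties.CommutativeSemigroup *-commutativeSemigroup using (interchange)
  open import Relation.Binary.PropositionalEquality using (_≡_; refl; sym; trans; cong; subst)
  open ≤-Reasoning

  ^-distribʳ-* : ∀ a b n → (a * b) ^ n ≡ a ^ n * b ^ n
  ^-distribʳ-* a b zero    = refl
  ^-distribʳ-* a b (suc n) = trans (cong (a * b *_) (^-distribʳ-* a b n)) (interchange a b (a ^ n) (b ^ n))

  m*m≤n*n⇒m≤n : ∀ {m n} → m * m ≤ n * n → m ≤ n
  m*m≤n*n⇒m≤n m*m≤n*n = ≮⇒≥ (λ n<m → <⇒≱ (*-mono-< n<m n<m) m*m≤n*n)

  bernoulli : ∀ y m → y ^ m * (y + m) ≤ suc y ^ m * y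
  bernoulli y zero    = ≤-reflexive (cong (1 *_) (+-identityʳ y))
  bernoulli y (suc m) = begin
    y * y ^ m * (y + suc m)               ≡⟨ split y (y ^ m) m ⟩
    y * (y ^ m * (y + m)) + y ^ m * y     ≤⟨ +-mono-≤ (*-monoʳ-≤ y (bernoulli y m)) (*-monoˡ-≤ y (^-monoˡ-≤ m (n≤1+n y))) ⟩
    y * (suc y ^ m * y) + suc y ^ m * y   ≡⟨ merge y (suc y ^ m) ⟩
    suc y * suc y ^ m * y                 ∎
    where
    split : ∀ y Y m → y * Y * (y + suc m) ≡ y * (Y * (y + m)) + Y * y
    split = solve-∀
    merge : ∀ y Z → y * (Z * y) + Z * y ≡ suc y * Z * y
    merge = solve-∀

  k*y^[k*y]≤[1+y]^[k*y] : ∀ k y .{{_ : NonZero y}} → k * y ^ (k * y) ≤ suc y ^ (k * y)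
  k*y^[k*y]≤[1+y]^[k*y] k y = *-cancelʳ-≤ _ _ y (begin
    k * Y * y           ≤⟨ m≤n+m (k * Y * y) (Y * y) ⟩
    Y * y + k * Y * y   ≡⟨ factor Y y k ⟩
    Y * (y + k * y)     ≤⟨ bernoulli y (k * y) ⟩
    suc y ^ (k * y) * y ∎)
    where
    Y : ℕ
    Y = y ^ (k * y)
    factor : ∀ Y y k → Y * y + k * Y * y ≡ Y * (y + k * y)
    factor = solve-∀

  k^r*y^n≤[1+y]^n : ∀ k y r n .{{_ : NonZero y}} → k * y * r ≤ n → k ^ r * y ^ n ≤ suc y ^ n
  k^r*y^n≤[1+y]^n k y r n kyr≤n = subst (λ m → k ^ r * y ^ m ≤ suc y ^ m)
    (trans (cong (_+ (n ∸ k * y * r)) (*-comm r (k * y))) (m+[n∸m]≡n kyr≤n)) (blocks r (n ∸ k * y * r))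
    where
    K : ℕ
    K = k * y
    split : ∀ b r s → b ^ (K + r * K + s) ≡ b ^ K * b ^ (r * K + s)
    split b r s = trans (cong (b ^_) (+-assoc K (r * K) s)) (^-distribˡ-+-* b K (r * K + s))
    blocks : ∀ r s → k ^ r * y ^ (r * K + s) ≤ suc y ^ (r * K + s)
    blocks zero    s = begin
      1 * y ^ s ≡⟨ *-identityˡ (y ^ s) ⟩
      y ^ s     ≤⟨ ^-monoˡ-≤ s (n≤1+n y) ⟩
      suc y ^ s ∎
    blocks (suc r) s = begin
      k * k ^ r * y ^ (K + r * K + s)                    ≡⟨ cong (k * k ^ r *_) (split y r s) ⟩
      k * k ^ r * (y ^ K * y ^ (r * K + s))              ≡⟨ interchange k (k ^ r) (y ^ K) (y ^ (r * K + s)) ⟩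
      k * y ^ K * (k ^ r * y ^ (r * K + s))              ≤⟨ *-mono-≤ (k*y^[k*y]≤[1+y]^[k*y] k y) (blocks r s) ⟩
      suc y ^ K * suc y ^ (r * K + s)                    ≡⟨ split (suc y) r s ⟨
      suc y ^ (K + r * K + s)                            ∎

  module _ (g : ℕ) where

    private
      D C : ℕ
      D = 2 + g
      C = suc g

    -- D·C² = g·D² + D, so this y satisfies g·D² < y and y + 1 ≤ D·C².
    bernoulliBase : ℕ
    bernoulliBase = suc (g * D * D)

    correlation-decay : ∀ q n P c → 2 + g ≤ q * (q * q) → c * c ≤ q ^ n * P * g ^ n →
      P * bernoulliBase ^ n ≤ suc bernoulliBase ^ n → D ^ n * c ≤ q ^ n * q ^ n * C ^ n
    correlation-decay q n P c D≤q³ c²≤ Py^n≤ = m*m≤n*n⇒m≤n (begin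
      D ^ n * c * (D ^ n * c)                   ≡⟨ interchange (D ^ n) c (D ^ n) c ⟩
      D ^ n * D ^ n * (c * c)                   ≤⟨ *-monoʳ-≤ (D ^ n * D ^ n) c²≤ ⟩
      D ^ n * D ^ n * (N * P * g ^ n)           ≡⟨ regroup (D ^ n) P N (g ^ n) ⟩
      N * (P * (g ^ n * D ^ n * D ^ n))         ≡⟨ cong (λ x → N * (P * x)) (sym (^-distribʳ-*³ g D D)) ⟩
      N * (P * (g * D * D) ^ n)                 ≤⟨ *-monoʳ-≤ N (*-monoʳ-≤ P (^-monoˡ-≤ n (n≤1+n _))) ⟩
      N * (P * bernoulliBase ^ n)              ≤⟨ *-monoʳ-≤ N Py^n≤ ⟩
      N * suc bernoulliBase ^ n                ≤⟨ *-monoʳ-≤ N (^-monoˡ-≤ n 2+y≤DC²) ⟩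
      N * (D * C * C) ^ n                       ≡⟨ cong (N *_) (^-distribʳ-*³ D C C) ⟩
      N * (D ^ n * C ^ n * C ^ n)               ≤⟨ *-monoʳ-≤ N (*-monoˡ-≤ (C ^ n) (*-monoˡ-≤ (C ^ n) Dⁿ≤N³)) ⟩
      N * (N * (N * N) * C ^ n * C ^ n)         ≡⟨ regroup′ N (C ^ n) ⟩
      N * N * C ^ n * (N * N * C ^ n)           ∎)
      where
      N : ℕ
      N = q ^ n
      2+y≤DC² : suc bernoulliBase ≤ D * C * C
      2+y≤DC² = subst (suc bernoulliBase ≤_) (expand g) (m≤m+n (suc bernoulliBase) g)
        where
        expand : ∀ g → 2 + g * (2 + g) * (2 + g) + g ≡ (2 + g) * suc g * suc g
        expand = solve-∀
      ^-distribʳ-*³ : ∀ a b c → (a * b * c) ^ n ≡ a ^ n * b ^ n * c ^ n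
      ^-distribʳ-*³ a b c = trans (^-distribʳ-* (a * b) c n) (cong (_* c ^ n) (^-distribʳ-* a b n))
      Dⁿ≤N³ : D ^ n ≤ N * (N * N)
      Dⁿ≤N³ = begin
        D ^ n                 ≤⟨ ^-monoˡ-≤ n D≤q³ ⟩
        (q * (q * q)) ^ n     ≡⟨ trans (^-distribʳ-* q (q * q) n) (cong (N *_) (^-distribʳ-* q q n)) ⟩
        N * (N * N)           ∎
      regroup : ∀ E P N G → E * E * (N * P * G) ≡ N * (P * (G * E * E))
      regroup = solve-∀
      regroup′ : ∀ N Z → N * (N * (N * N) * Z * Z) ≡ N * N * Z * (N * N * Z)
      regroup′ = solve-∀

  av≤2vm+2au : ∀ a m c u v → a ≤ 2 * m + c → v * c ≤ a * u → a * v ≤ 2 * v * m + 2 * a * u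
  av≤2vm+2au a m c u v a≤2m+c vc≤au = begin
    a * v                       ≤⟨ *-monoˡ-≤ v a≤2m+c ⟩
    (2 * m + c) * v             ≡⟨ expand m c v ⟩
    2 * v * m + v * c           ≤⟨ +-monoʳ-≤ (2 * v * m) (≤-trans vc≤au (m≤n+m (a * u) (a * u))) ⟩
    2 * v * m + (a * u + a * u) ≡⟨ cong (2 * v * m +_) (double a u) ⟩
    2 * v * m + 2 * a * u       ∎
    where
    expand : ∀ m c v → (2 * m + c) * v ≡ 2 * v * m + v * c
    expand = solve-∀
    double : ∀ a u → a * u + a * u ≡ 2 * a * u
    double = solve-∀

open Arithmetic

module RationalBounds where

  open import Data.Nat as ℕ using (zero; suc; NonZero; _^_)
  import Data.Nat.Properties as ℕ
  open import Data.Integer as ℤ using (+_)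
  import Data.Integer.Properties as ℤ
  open import Data.Rational using (ℚ; _/_; _+_; _*_; -_; _-_; _≤_; _<_; 0ℚ; 1ℚ; ½)
  import Data.Rational.Properties as ℚ
  open import Data.Rational.Unnormalised as ℚᵘ using (*<*)
  import Data.Rational.Unnormalised.Properties as ℚᵘ
  open import Data.Rational.Solver using (module +-*-Solver)
  open import Algebra.Bundles using (CommutativeRing)
  open import Algebra.Properties.CommutativeSemigroup (CommutativeRing.*-commutativeSemigroup ℚ.+-*-commutativeRing) using (interchange)
  open import Relation.Binary.PropositionalEquality using (_≡_; refl; sym; trans; cong; cong₂; subst₂; module ≡-Reasoning)

  0<[1+m]/d : ∀ m d .{{_ : NonZero d}} → 0ℚ < + suc m / d
  0<[1+m]/d m d = ℚ.positive⁻¹ (+ suc m / d) {{ℚ.normalize-pos (suc m) d}}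

  m/d<1 : ∀ m d .{{_ : NonZero d}} → m ℕ.< d → + m / d < 1ℚ
  m/d<1 m (suc d) m<d = ℚ.toℚᵘ-cancel-<
    (ℚᵘ.<-respˡ-≃ (ℚᵘ.≃-sym (ℚ.toℚᵘ-fromℚᵘ (ℚᵘ.mkℚᵘ (+ m) d)))
        (*<* (subst₂ ℤ._<_ (sym (ℤ.*-identityʳ (+ m))) (sym (ℤ.*-identityˡ (+ suc d))) (ℤ.+<+ m<d))))

  ℕtoℚ-^-powℚ : ∀ c d .{{_ : NonZero d}} n → ℕtoℚ (d ^ n) * powℚ (+ c / d) n ≡ ℕtoℚ (c ^ n)
  ℕtoℚ-^-powℚ c d zero    = ℚ.*-identityʳ (ℕtoℚ 1)
  ℕtoℚ-^-powℚ c d (suc n) = begin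
    ℕtoℚ (d ℕ.* d ^ n) * (+ c / d * powℚ (+ c / d) n)
      ≡⟨ cong (_* (+ c / d * powℚ (+ c / d) n)) (ℕtoℚ-* d (d ^ n)) ⟩
    ℕtoℚ d * ℕtoℚ (d ^ n) * (+ c / d * powℚ (+ c / d) n)        ≡⟨ interchange (ℕtoℚ d) _ _ _ ⟩
    ℕtoℚ d * (+ c / d) * (ℕtoℚ (d ^ n) * powℚ (+ c / d) n)      ≡⟨ cong₂ _*_ (ι-*-/ (+ c) d) (ℕtoℚ-^-powℚ c d n) ⟩
    ℕtoℚ c * ℕtoℚ (c ^ n)                                        ≡⟨ ℕtoℚ-* c (c ^ n) ⟨
    ℕtoℚ (c ℕ.* c ^ n)                                           ∎
    where open ≡-Reasoning

  r≤n/k⇒k*r≤n : ∀ k r n .{{_ : NonZero k}} → ℕtoℚ r ≤ + 1 / k * ℕtoℚ n → k ℕ.* r ℕ.≤ n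
  r≤n/k⇒k*r≤n k r n r≤n/k = ℕtoℚ-cancel-≤ (begin
    ℕtoℚ (k ℕ.* r)                  ≡⟨ ℕtoℚ-* k r ⟩
    ℕtoℚ k * ℕtoℚ r                 ≤⟨ ℚ.*-monoˡ-≤-nonNeg (ℕtoℚ k) {{ℚ.normalize-nonNeg k 1}} r≤n/k ⟩
    ℕtoℚ k * (+ 1 / k * ℕtoℚ n)     ≡⟨ ℚ.*-assoc (ℕtoℚ k) _ _ ⟨
    ℕtoℚ k * (+ 1 / k) * ℕtoℚ n     ≡⟨ cong (_* ℕtoℚ n) (ι-*-/ (+ 1) k) ⟩
    1ℚ * ℕtoℚ n                     ≡⟨ ℚ.*-identityˡ (ℕtoℚ n) ⟩
    ℕtoℚ n                          ∎)
    where open ℚ.≤-Reasoning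

  a*[½-w]≤m : ∀ a m u v .{{_ : NonZero v}} (w : ℚ) → ℕtoℚ v * w ≡ ℕtoℚ u →
              a ℕ.* v ℕ.≤ 2 ℕ.* v ℕ.* m ℕ.+ 2 ℕ.* a ℕ.* u → ℕtoℚ a * (½ - w) ≤ ℕtoℚ m
  a*[½-w]≤m a m u v w vw≡u av≤ =
    ℚ.*-cancelˡ-≤-pos (ℕtoℚ (2 ℕ.* v)) {{ℚ.normalize-pos (2 ℕ.* v) 1 {{_}} {{ℕ.m*n≢0 2 v}}}} (begin
    ℕtoℚ (2 ℕ.* v) * (A * (½ - w))      ≡⟨ cong (_* (A * (½ - w))) (ℕtoℚ-* 2 v) ⟩
    T * V * (A * (½ - w))               ≡⟨ expand T V A w ½ ⟩
    A * V * (T * ½) - T * A * (V * w)   ≡⟨ cong₂ (λ x y → A * V * x - T * A * y) refl vw≡u ⟩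
    A * V * 1ℚ - T * A * U              ≡⟨ cong (_- T * A * U) (ℚ.*-identityʳ (A * V)) ⟩
    A * V - T * A * U                   ≤⟨ ℚ.+-monoˡ-≤ (- (T * A * U)) av≤ℚ ⟩
    T * V * M + T * A * U - T * A * U   ≡⟨ cancel (T * V * M) (T * A * U) ⟩
    T * V * M                           ≡⟨ cong (_* M) (ℕtoℚ-* 2 v) ⟨
    ℕtoℚ (2 ℕ.* v) * M                  ∎)
    where
    open ℚ.≤-Reasoning
    open +-*-Solver
    T A V M U : ℚ
    T = ℕtoℚ 2
    A = ℕtoℚ a
    V = ℕtoℚ v
    M = ℕtoℚ m
    U = ℕtoℚ u
    expand : ∀ t v a w h → t * v * (a * (h - w)) ≡ a * v * (t * h) - t * a * (v * w)
    expand = solve 5 (λ t v a w h → t :* v :* (a :* (h :- w)) := a :* v :* (t :* h) :- t :* a :* (v :* w)) refl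
    cancel : ∀ x y → x + y - y ≡ x
    cancel = solve 2 (λ x y → x :+ y :- y := x) refl
    av≤ℚ : A * V ≤ T * V * M + T * A * U
    av≤ℚ = begin
      A * V                          ≡⟨ ℕtoℚ-* a v ⟨
      ℕtoℚ (a ℕ.* v)                 ≤⟨ ℕtoℚ-mono-≤ av≤ ⟩
      ℕtoℚ (2 ℕ.* v ℕ.* m ℕ.+ 2 ℕ.* a ℕ.* u)
        ≡⟨ trans (ℕtoℚ-+ (2 ℕ.* v ℕ.* m) _) (cong₂ _+_
             (trans (ℕtoℚ-* (2 ℕ.* v) m) (cong (_* M) (ℕtoℚ-* 2 v)))
             (trans (ℕtoℚ-* (2 ℕ.* a) u) (cong (_* U) (ℕtoℚ-* 2 a)))) ⟩
      T * V * M + T * A * U          ∎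

open RationalBounds

open import Data.Nat as ℕ using (ℕ; NonZero; _^_)
open import Data.Nat.Primality using (Prime)
open import Data.Fin using (Fin)
open import Data.Integer using (ℤ)
open import Data.Rational using (ℚ; _<_; _*_; _-_; 0ℚ; 1ℚ; ½)
open import Data.Product using (Σ; _×_)
open import Relation.Nullary using (¬_)

open import Data.Nat using (suc)
import Data.Nat.Properties as ℕ
open import Data.Integer using (+_; ∣_∣)
open import Data.Rational using (_/_; _≤_)
open import Data.Product using (_,_)
open import Relation.Binary.PropositionalEquality using (_≡_; sym; trans; cong; subst)

q^[2*n]≡q^n*q^n : ∀ q n → q ^ (2 ℕ.* n) ≡ q ^ n ℕ.* q ^ n
q^[2*n]≡q^n*q^n q n = trans (cong (q ^_) (cong (n ℕ.+_) (ℕ.+-identityʳ n))) (ℕ.^-distribˡ-+-* q n n)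

theorem1p2 : (p : ℕ) → .{{_ : NonZero p}} → Prime p →
    (q : ℕ) → .{{_ : NonZero q}} →
    (A : Fin q → Fin q → ℤ) → IsSignMatrix A → ¬ RankℚAtMostOne A →
    Σ ℚ λ c₁ → Σ ℚ λ c₂ → (0ℚ < c₁) × (0ℚ < c₂) × (c₂ < 1ℚ) ×
      (∀ (n : ℕ) → .{{_ : NonZero n}} →
        RigidityAtLeast p n (kronPow A n) (c₁ * ℕtoℚ n)
          (ℕtoℚ (q ^ (2 ℕ.* n)) * (½ - powℚ c₂ n)))
theorem1p2 p _ (suc q) A A± ¬rank≤1 with mixed-columns A± ¬rank≤1
... | _ , _ , c≁0 = c₁ , c₂ , 0<[1+m]/d 0 (p ℕ.* y) , 0<[1+m]/d g (2 ℕ.+ g) , m/d<1 (suc g) (2 ℕ.+ g) ℕ.≤-refl , rigidity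
  where
  g y : ℕ
  g = gramNorm A
  y = bernoulliBase g
  instance
    p*y≢0 : NonZero (p ℕ.* y)
    p*y≢0 = ℕ.m*n≢0 p y
  c₁ c₂ : ℚ
  c₁ = + 1 / (p ℕ.* y)
  c₂ = + suc g / (2 ℕ.+ g)
  rigidity : ∀ n .{{_ : NonZero n}} →
    RigidityAtLeast p n (kronPow A n) (c₁ * ℕtoℚ n) (ℕtoℚ (suc q ^ (2 ℕ.* n)) * (½ - powℚ c₂ n))
  rigidity n r r≤c₁n L L-rank = subst (λ a → ℕtoℚ a * (½ - powℚ c₂ n) ≤ ℕtoℚ m) (sym (q^[2*n]≡q^n*q^n (suc q) n))
    (a*[½-w]≤m (N ℕ.* N) m (suc g ^ n) ((2 ℕ.+ g) ^ n) (powℚ c₂ n) (ℕtoℚ-^-powℚ (suc g) (2 ℕ.+ g) n) counting)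
    where
    N m corr : ℕ
    N = suc q ^ n
    m = mismatches n (kronPow A n) L
    corr = ∣ correlation A± p n r L ∣
    instance
      [2+g]^n≢0 : NonZero ((2 ℕ.+ g) ^ n)
      [2+g]^n≢0 = ℕ.m^n≢0 (2 ℕ.+ g) n
    p^r*y^n≤[1+y]^n : p ^ r ℕ.* y ^ n ℕ.≤ suc y ^ n
    p^r*y^n≤[1+y]^n = k^r*y^n≤[1+y]^n p y r n (r≤n/k⇒k*r≤n (p ℕ.* y) r n r≤c₁n)
    decay : (2 ℕ.+ g) ^ n ℕ.* corr ℕ.≤ N ℕ.* N ℕ.* suc g ^ n
    decay = correlation-decay g (suc q) n (p ^ r) corr (gramNorm+2≤ A± c≁0) (correlation² A± p n r L L-rank) p^r*y^n≤[1+y]^n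
    counting : N ℕ.* N ℕ.* (2 ℕ.+ g) ^ n ℕ.≤ 2 ℕ.* (2 ℕ.+ g) ^ n ℕ.* m ℕ.+ 2 ℕ.* (N ℕ.* N) ℕ.* suc g ^ n
    counting = av≤2vm+2au (N ℕ.* N) m corr (suc g ^ n) ((2 ℕ.+ g) ^ n) (mismatches-lower-bound A± p n r L) decay
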